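{- Let $n>2$ be an integer and $r\ge1$ an integer with $2^r+1<2^n$, let $s_i=(2^r+1)2^{n+i}+1$ for $i\in\mathbb{N}$, and let $S=P_{2^r+1}(n)$. Then (1) $w(2)=s_1+s_n+s_{n+r}$; (2) $w(1)=2s_1+s_n+s_{n+r}$; in particular $w(1)-w(2)=s_1$.
   Context: $P_{2^r+1}(n)$ is the numerical semigroup consisting of all finite non-negative integer linear combinations of $\{(2^r+1)2^{n+i}+1\mid i\in\mathbb{N}\}$. For an integer $i$, $w(i)$ denotes the least element of $S$ congruent to $i$ modulo $s_0$. -}

module Defs where

open import Data.Nat using (ℕ; zero; suc; _+_; _*_; _^_; _≤_; _%_)
open import Data.List using (List; map)
open import Data.Nat.ListAction using (sum)
open import Data.Product using (∃; _×_)
open import Relation.Binary.PropositionalEquality using (_≡_)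

gen : ℕ → ℕ → ℕ → ℕ
gen a n i = a * 2 ^ (n + i) + 1

-- membership in P_a(n): x is a finite non-negative integer linear
-- combination of the generators, i.e. a sum of a finite list
-- (with repetitions) of generators; the empty list gives 0.
InP : ℕ → ℕ → ℕ → Set
InP a n x = ∃ λ (is : List ℕ) → sum (map (gen a n) is) ≡ x

-- Apéry-type element: w is the least element of S = P_a(n) congruent
-- to i modulo s_0 = gen a n 0.
IsW : ℕ → ℕ → ℕ → ℕ → Set
IsW a n i w =
  InP a n w × (w % suc (a * 2 ^ n)) ≡ (i % suc (a * 2 ^ n)) ×
  (∀ y → InP a n y → (y % suc (a * 2 ^ n)) ≡ (i % suc (a * 2 ^ n)) → w ≤ y)

{-# OPTIONS --safe #-}
module Submission where

-- Write m = a·2ⁿ, so that s_i = m·2^i + 1 ≡ 2^i − 1 (mod s₀ = m + 1). An element of S built from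
-- k generators is m(k + d) + k, where k + d is a sum of k powers of two, and it is ≡ −d (mod m + 1).
-- Hence in the class of c ∈ {1, 2} either d ≥ m + 1 + d₀ with d₀ = m + 1 − c, which is too large,
-- or d = d₀ and the element grows with k. The least admissible k is 3 (resp. 4): otherwise
-- m + 1 (resp. m + 3) would be a sum of at most 2 (resp. 3) powers of two, and halving away the
-- binary digits would exhibit the odd factor a > 1 of m as a power of two.

open import Defs
open import Data.Nat using (ℕ; zero; suc; _+_; _*_; _^_; _<_; _≤_; _∸_; _%_; z≤n; s≤s; _≤′_; ≤′-reflexive; ≤′-step; _≤?_)
open import Data.Nat.Properties
open import Data.Nat.DivMod using (%-distribˡ-+; [m+n]%n≡m%n; [m+kn]%n≡m%n; m*n%n≡0)
open import Data.Nat.Divisibility using (divides; m%n≡0⇒n∣m)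
open import Data.Nat.ListAction using (sum)
open import Data.Nat.Tactic.RingSolver using (solve-∀)
open import Data.List using (List; []; _∷_; map; length)
open import Data.Product using (_×_; _,_; ∃; ∃₂)
open import Data.Sum using (_⊎_; inj₁; inj₂)
open import Data.Empty using (⊥-elim)
open import Relation.Nullary using (¬_; yes; no)
open import Relation.Binary.PropositionalEquality using (_≡_; _≢_; refl; sym; trans; cong; cong₂; subst; module ≡-Reasoning)

pow2Sum : List ℕ → ℕ
pow2Sum is = sum (map (2 ^_) is)

PowSum : ℕ → ℕ → Set
PowSum k N = ∃ λ is → length is ≤ k × pow2Sum is ≡ N

halvePowers : ∀ is → ∃ λ js →
  (pow2Sum is ≡ 2 * pow2Sum js × length js ≤ length is) ⊎
  (pow2Sum is ≡ 1 + 2 * pow2Sum js × suc (length js) ≤ length is)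
halvePowers [] = [] , inj₁ (refl , z≤n)
halvePowers (suc i ∷ is) with halvePowers is
... | js , inj₁ (e , l) =
  i ∷ js , inj₁ (trans (cong (2 * 2 ^ i +_) e) (sym (*-distribˡ-+ 2 (2 ^ i) (pow2Sum js))) , s≤s l)
... | js , inj₂ (e , l) =
  i ∷ js , inj₂ (trans (cong (2 * 2 ^ i +_) e) (odd (2 ^ i) (pow2Sum js)) , s≤s l)
  where
  odd : ∀ x y → 2 * x + (1 + 2 * y) ≡ 1 + 2 * (x + y)
  odd = solve-∀
halvePowers (zero ∷ is) with halvePowers is
... | js , inj₁ (e , l) = js , inj₂ (cong suc e , s≤s l)
... | js , inj₂ (e , l) =
  zero ∷ js , inj₁ (trans (cong suc e) (carry (pow2Sum js)) , m≤n⇒m≤1+n l)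
  where
  carry : ∀ y → 1 + (1 + 2 * y) ≡ 2 * (1 + y)
  carry = solve-∀

PowSum-zero : ∀ {N} → PowSum 0 N → N ≡ 0
PowSum-zero ([] , _ , e) = sym e

PowSum-even : ∀ {k M} → PowSum k (2 * M) → PowSum k M
PowSum-even {M = M} (is , l , e) with halvePowers is
... | js , inj₁ (e′ , l′) = js , ≤-trans l′ l , *-cancelˡ-≡ _ _ 2 (trans (sym e′) e)
... | js , inj₂ (e′ , _) = ⊥-elim (even≢odd M (pow2Sum js) (trans (sym e) e′))

PowSum-odd : ∀ {k M} → PowSum (suc k) (1 + 2 * M) → PowSum k M
PowSum-odd {M = M} (is , l , e) with halvePowers is
... | js , inj₁ (e′ , _) = ⊥-elim (even≢odd (pow2Sum js) M (trans (sym e′) e))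
... | js , inj₂ (e′ , l′) =
  js , ≤-pred (≤-trans l′ l) , *-cancelˡ-≡ _ _ 2 (suc-injective (trans (sym e′) e))

PowSum-pad : ∀ {k K d} → k ≤′ K → PowSum k (k + d) → PowSum K (K + d)
PowSum-pad (≤′-reflexive refl) ps = ps
PowSum-pad (≤′-step k≤′K) ps with PowSum-pad k≤′K ps
... | is , l , e = zero ∷ is , s≤s l , cong suc e

*2^suc : ∀ a n → a * 2 ^ suc n ≡ 2 * (a * 2 ^ n)
*2^suc a n = swap a (2 ^ n)
  where
  swap : ∀ a x → a * (2 * x) ≡ 2 * (a * x)
  swap = solve-∀

PowSum1-oddFactor : ∀ n {a P} → a ≡ 1 + 2 * P → PowSum 1 (a * 2 ^ n) → P ≡ 0
PowSum1-oddFactor zero {a} refl ps =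
  PowSum-zero (PowSum-odd (subst (PowSum 1) (*-identityʳ a) ps))
PowSum1-oddFactor (suc n) {a} a≡ ps =
  PowSum1-oddFactor n a≡ (PowSum-even (subst (PowSum 1) (*2^suc a n) ps))

sum-gen : ∀ a n is → sum (map (gen a n) is) ≡ a * 2 ^ n * pow2Sum is + length is
sum-gen a n [] = sym (trans (+-identityʳ _) (*-zeroʳ (a * 2 ^ n)))
sum-gen a n (i ∷ is) = begin
  a * 2 ^ (n + i) + 1 + sum (map (gen a n) is)
    ≡⟨ cong₂ (λ p s → a * p + 1 + s) (^-distribˡ-+-* 2 n i) (sum-gen a n is) ⟩
  a * (2 ^ n * 2 ^ i) + 1 + (a * 2 ^ n * pow2Sum is + length is)
    ≡⟨ regroup a (2 ^ n) (2 ^ i) (pow2Sum is) (length is) ⟩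
  a * 2 ^ n * (2 ^ i + pow2Sum is) + suc (length is) ∎
  where
  open ≡-Reasoning
  regroup : ∀ a x y p l → a * (x * y) + 1 + (a * x * p + l) ≡ a * x * (y + p) + suc l
  regroup = solve-∀

length≤pow2Sum : ∀ is → length is ≤ pow2Sum is
length≤pow2Sum [] = z≤n
length≤pow2Sum (i ∷ is) = +-mono-≤ (m^n>0 2 i) (length≤pow2Sum is)

InP⇒shape : ∀ {a n y} → InP a n y →
  ∃₂ λ k d → PowSum k (k + d) × y ≡ a * 2 ^ n * (k + d) + k
InP⇒shape {a} {n} (is , refl) with m≤n⇒∃[o]m+o≡n (length≤pow2Sum is)
... | d , e = length is , d , (is , ≤-refl , sym e) ,
              trans (sum-gen a n is) (cong (λ t → a * 2 ^ n * t + length is) (sym e))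

shape-% : ∀ {m c K d₀} → suc c + d₀ ≡ suc m → (m * (K + d₀) + K) % suc m ≡ suc c % suc m
shape-% {c = c} {K} {d₀} refl = begin
  ((c + d₀) * (K + d₀) + K) % s       ≡⟨ [m+n]%n≡m%n ((c + d₀) * (K + d₀) + K) s ⟨
  ((c + d₀) * (K + d₀) + K + s) % s   ≡⟨ cong (_% s) (shift c d₀ K) ⟩
  (suc c + (K + d₀) * s) % s          ≡⟨ [m+kn]%n≡m%n (suc c) (K + d₀) s ⟩
  suc c % s                           ∎
  where
  open ≡-Reasoning
  s = suc (c + d₀)
  shift : ∀ c d K → (c + d) * (K + d) + K + suc (c + d) ≡ suc c + (K + d) * suc (c + d)
  shift = solve-∀

residue-dichotomy : ∀ {m c k d y} → y ≡ m * (k + d) + k → y % suc m ≡ suc c % suc m →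
  suc c + d ≡ suc m ⊎ 2 * suc m ≤ suc c + d
residue-dichotomy {m} {c} {k} {d} {y} y≡ y≡c with m%n≡0⇒n∣m (suc c + d) (suc m) c+d≡0
  where
  open ≡-Reasoning
  s = suc m
  regroup : ∀ m k d → m * (k + d) + k + d ≡ (k + d) * suc m
  regroup = solve-∀
  c+d≡0 : (suc c + d) % s ≡ 0
  c+d≡0 = begin
    (suc c + d) % s            ≡⟨ %-distribˡ-+ (suc c) d s ⟩
    (suc c % s + d % s) % s    ≡⟨ cong (λ x → (x + d % s) % s) y≡c ⟨
    (y % s + d % s) % s        ≡⟨ %-distribˡ-+ y d s ⟨
    (y + d) % s                ≡⟨ cong (_% s) (trans (cong (_+ d) y≡) (regroup m k d)) ⟩
    (k + d) * s % s            ≡⟨ m*n%n≡0 (k + d) s ⟩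
    0                          ∎
... | divides zero ()
... | divides 1 e = inj₁ (trans e (+-identityʳ (suc m)))
... | divides (suc (suc q)) e =
  inj₂ (subst (2 * suc m ≤_) (sym e) (+-monoʳ-≤ (suc m) (+-monoʳ-≤ (suc m) z≤n)))

apery-bound : ∀ {m c K d₀ k d y} → K ≤ m → suc c + d₀ ≡ suc m →
  y ≡ m * (k + d) + k → y % suc m ≡ suc c % suc m →
  (k < K → suc c + d ≢ suc m) → m * (K + d₀) + K ≤ y
apery-bound {m} {c} {K} {d₀} {k} {d} {y} K≤m c+d₀ y≡ y≡c small
  with residue-dichotomy y≡ y≡c | K ≤? k
... | inj₁ c+d | no K≰k = ⊥-elim (small (≰⇒> K≰k) c+d)
... | inj₁ c+d | yes K≤k = begin
  m * (K + d₀) + K  ≤⟨ +-mono-≤ (*-monoʳ-≤ m (+-mono-≤ K≤k (≤-reflexive d₀≡d))) K≤k ⟩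
  m * (k + d) + k   ≡⟨ y≡ ⟨
  y                 ∎
  where
  open ≤-Reasoning
  d₀≡d : d₀ ≡ d
  d₀≡d = +-cancelˡ-≡ (suc c) d₀ d (trans c+d₀ (sym c+d))
... | inj₂ far | _ = begin
  m * (K + d₀) + K    ≡⟨ split m K d₀ ⟩
  suc m * K + m * d₀  ≤⟨ +-monoˡ-≤ (m * d₀) (*-monoʳ-≤ (suc m) K≤m) ⟩
  suc m * m + m * d₀  ≡⟨ merge m d₀ ⟩
  m * (suc m + d₀)    ≤⟨ *-monoʳ-≤ m (≤-trans d-large (m≤n+m d k)) ⟩
  m * (k + d)         ≤⟨ m≤m+n (m * (k + d)) k ⟩
  m * (k + d) + k     ≡⟨ y≡ ⟨
  y                   ∎
  where
  open ≤-Reasoning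
  split : ∀ m K d → m * (K + d) + K ≡ suc m * K + m * d
  split = solve-∀
  merge : ∀ m d → suc m * m + m * d ≡ m * (suc m + d)
  merge = solve-∀
  swap : ∀ c m d → suc c + (suc m + d) ≡ suc m + (suc c + d)
  swap = solve-∀
  d-large : suc m + d₀ ≤ d
  d-large = +-cancelˡ-≤ (suc c) _ _ (begin
    suc c + (suc m + d₀)  ≡⟨ swap c m d₀ ⟩
    suc m + (suc c + d₀)  ≡⟨ cong (suc m +_) (trans c+d₀ (sym (+-identityʳ (suc m)))) ⟩
    2 * suc m             ≤⟨ far ⟩
    suc c + d             ∎)

IsW-criterion : ∀ {a n c d₀} (L : List ℕ) →
  length L ≤ a * 2 ^ n → suc c + d₀ ≡ suc (a * 2 ^ n) → pow2Sum L ≡ length L + d₀ →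
  (∀ {k d} → k < length L → suc c + d ≡ suc (a * 2 ^ n) → ¬ PowSum k (k + d)) →
  IsW a n (suc c) (sum (map (gen a n) L))
IsW-criterion {a} {n} {c} {d₀} L K≤m c+d₀ L-sum noSmaller =
  (L , refl) , subst (λ w → w % suc m ≡ suc c % suc m) (sym W≡) (shape-% c+d₀) , minimal
  where
  m = a * 2 ^ n
  W≡ : sum (map (gen a n) L) ≡ m * (length L + d₀) + length L
  W≡ = trans (sum-gen a n L) (cong (λ t → m * t + length L) L-sum)
  minimal : ∀ y → InP a n y → y % suc m ≡ suc c % suc m → sum (map (gen a n) L) ≤ y
  minimal y y∈S y≡c with InP⇒shape {a} {n} y∈S
  ... | k , d , ps , y≡ =
    subst (_≤ y) (sym W≡) (apery-bound K≤m c+d₀ y≡ y≡c (λ k<K c+d → noSmaller k<K c+d ps))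

noSmallW₂ : ∀ {a P n k d} → a ≡ 1 + 2 * P → P ≢ 0 → k < 3 →
  2 + d ≡ suc (a * 2 ^ suc n) → ¬ PowSum k (k + d)
noSmallW₂ {a} {n = n} a≡ P≢0 k<3 2+d≡ ps = P≢0 (PowSum1-oddFactor n a≡ (PowSum-odd ps₂))
  where
  ps₂ : PowSum 2 (1 + 2 * (a * 2 ^ n))
  ps₂ = subst (PowSum 2) (trans 2+d≡ (cong suc (*2^suc a n))) (PowSum-pad (≤⇒≤′ (≤-pred k<3)) ps)

noSmallW₁ : ∀ {a P n k d} → a ≡ 1 + 2 * P → P ≢ 0 → k < 4 →
  1 + d ≡ suc (a * 2 ^ suc (suc n)) → ¬ PowSum k (k + d)
noSmallW₁ {a} {n = n} a≡ P≢0 k<4 refl ps = P≢0 (PowSum1-oddFactor n a≡ (PowSum-odd (PowSum-odd ps₃)))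
  where
  carry : ∀ x → 3 + 2 * (2 * x) ≡ 1 + 2 * (1 + 2 * x)
  carry = solve-∀
  ps₃ : PowSum 3 (1 + 2 * (1 + 2 * (a * 2 ^ n)))
  ps₃ = subst (PowSum 3)
    (trans (cong (3 +_) (trans (*2^suc a (suc n)) (cong (2 *_) (*2^suc a n)))) (carry (a * 2 ^ n)))
    (PowSum-pad (≤⇒≤′ (≤-pred k<4)) ps)

2^n+2^[n+r] : ∀ n r → 2 ^ n + (2 ^ (n + r) + 0) ≡ (2 ^ r + 1) * 2 ^ n
2^n+2^[n+r] n r = trans (cong (λ x → 2 ^ n + (x + 0)) (^-distribˡ-+-* 2 n r)) (factor (2 ^ n) (2 ^ r))
  where
  factor : ∀ x y → x + (x * y + 0) ≡ (y + 1) * x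
  factor = solve-∀

lemma12 : (n r : ℕ) → 2 < n → 1 ≤ r → 2 ^ r + 1 < 2 ^ n →
    IsW (2 ^ r + 1) n 2 (gen (2 ^ r + 1) n 1 + gen (2 ^ r + 1) n n + gen (2 ^ r + 1) n (n + r))
    × IsW (2 ^ r + 1) n 1 (2 * gen (2 ^ r + 1) n 1 + gen (2 ^ r + 1) n n + gen (2 ^ r + 1) n (n + r))
    × (2 * gen (2 ^ r + 1) n 1 + gen (2 ^ r + 1) n n + gen (2 ^ r + 1) n (n + r))
      ∸ (gen (2 ^ r + 1) n 1 + gen (2 ^ r + 1) n n + gen (2 ^ r + 1) n (n + r))
      ≡ gen (2 ^ r + 1) n 1
lemma12 n@(suc (suc (suc n₀))) r@(suc r₀) (s≤s (s≤s (s≤s _))) (s≤s _) _ =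
    subst (IsW a n 2) (sum3 s₁ sₙ sₙ₊ᵣ)
      (IsW-criterion {a} {n} L₂ (≤-trans (n≤1+n 3) 4≤m) (cong suc m-1)
        (cong (2 +_) (trans top (sym m-1))) (noSmallW₂ {n = suc (suc n₀)} a-odd 2^r₀≢0))
  , subst (IsW a n 1) (sum4 s₁ sₙ sₙ₊ᵣ)
      (IsW-criterion {a} {n} L₁ 4≤m refl (cong (λ x → 2 + (2 + x)) top)
        (noSmallW₁ {n = suc n₀} a-odd 2^r₀≢0))
  , trans (cong (_∸ W₂) (sum4-sum3 s₁ sₙ sₙ₊ᵣ)) (m+n∸m≡n W₂ s₁)
  where
  a = 2 ^ r + 1
  s₁ = gen a n 1
  sₙ = gen a n n
  sₙ₊ᵣ = gen a n (n + r)
  W₂ = s₁ + sₙ + sₙ₊ᵣ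
  L₂ = 1 ∷ n ∷ n + r ∷ []
  L₁ = 1 ∷ 1 ∷ n ∷ n + r ∷ []
  a-odd : a ≡ 1 + 2 * 2 ^ r₀
  a-odd = +-comm (2 ^ r) 1
  2^r₀≢0 : 2 ^ r₀ ≢ 0
  2^r₀≢0 = >⇒≢ (m^n>0 2 r₀)
  4≤m : 4 ≤ a * 2 ^ n
  4≤m = *-mono-≤ (m≤n+m 1 (2 ^ r))
    (≤-trans (m≤m+n 4 4) (*-monoʳ-≤ 2 (*-monoʳ-≤ 2 (*-monoʳ-≤ 2 (m^n>0 2 n₀)))))
  m-1 : 1 + (a * 2 ^ n ∸ 1) ≡ a * 2 ^ n
  m-1 = m+[n∸m]≡n (≤-trans (m≤m+n 1 3) 4≤m)
  top : 2 ^ n + (2 ^ (n + r) + 0) ≡ a * 2 ^ n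
  top = 2^n+2^[n+r] n r
  sum3 : ∀ x y z → x + (y + (z + 0)) ≡ x + y + z
  sum3 = solve-∀
  sum4 : ∀ x y z → x + (x + (y + (z + 0))) ≡ 2 * x + y + z
  sum4 = solve-∀
  sum4-sum3 : ∀ x y z → 2 * x + y + z ≡ x + y + z + x
  sum4-sum3 = solve-∀
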